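{- For every context $\Gamma$, variables $x,y$ and terms $A,M,B$: if $y\notin\mathrm{dom}\,\Gamma$ and $\Gamma,x:A\vdash M:B$, then $\Gamma,y:A\vdash M[x:=\mathsf{v}\,y]:B[x:=\mathsf{v}\,y]$.
   Context: Variables $\mathcal{V}$: a type with decidable equality and maps $\mathrm{encode}:\mathcal{V}\to\mathbb{N}$, $\mathrm{decode}:\mathbb{N}\to\mathcal{V}$ with $\mathrm{encode}(\mathrm{decode}\,n)=n$. Constants $\mathcal{C}$: any type. Terms: $\mathsf{c}\,k$, $\mathsf{v}\,x$, $\lambda[x:A]M$, $\Pi[x:A]B$, $M\cdot N$. Free-variable list: $\mathrm{fv}(\mathsf{c}\,k)=[\,]$, $\mathrm{fv}(\mathsf{v}\,x)=[x]$, $\mathrm{fv}(\lambda[x:A]M)=\mathrm{fv}\,A\mathbin{++}(\mathrm{fv}\,M-x)$, likewise $\Pi$, $\mathrm{fv}(M\cdot N)=\mathrm{fv}\,M\mathbin{++}\mathrm{fv}\,N$ ($xs-x$ removes all occurrences of $x$). Substitutions $\sigma:\mathcal{V}\to\Lambda$; $\iota\,x=\mathsf{v}\,x$; $(\sigma,x:=N)$ sends $x$ to $N$, $y\neq x$ to $\sigma\,y$. Fix $\chi':\mathrm{List}\,\mathbb{N}\to\mathbb{N}$ with $\chi'(ns)\notin ns$; $X'(xs)=\mathrm{decode}(\chi'(\mathrm{map\ encode}\ xs))$; $X(\sigma,xs)=X'$(concatenation of $\mathrm{fv}(\sigma\,y)$ for $y$ in $xs$). Substitution: $\mathsf{c}\,k\bullet\sigma=\mathsf{c}\,k$,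 $\mathsf{v}\,x\bullet\sigma=\sigma\,x$, $(M\cdot N)\bullet\sigma=(M\bullet\sigma)\cdot(N\bullet\sigma)$, $(\lambda[x:A]M)\bullet\sigma=\lambda[y:A\bullet\sigma](M\bullet(\sigma,x:=\mathsf{v}\,y))$ with $y=X(\sigma,\mathrm{fv}\,M-x)$, analogously for $\Pi$ (with $y=X(\sigma,\mathrm{fv}\,B-x)$). $M[x:=N]=M\bullet(\iota,x:=N)$. Alpha-conversion $\sim_\alpha$: inductive, $\mathsf{c}\,k\sim_\alpha\mathsf{c}\,k$, $\mathsf{v}\,x\sim_\alpha\mathsf{v}\,x$, congruence for application, and $\lambda[x:A]M\sim_\alpha\lambda[x':A']M'$ whenever $A\sim_\alpha A'$, $y\notin\mathrm{fv}\,M-x$, $y\notin\mathrm{fv}\,M'-x'$ and $M[x:=\mathsf{v}\,y]=M'[x':=\mathsf{v}\,y]$ syntactically, for some $y$ (same for $\Pi$). Beta: the contextual closure of a relation $S$ is the least relation containing $S$ and closed under rewriting in the body or annotation of $\lambda$, in the codomain or domain of $\Pi$, and in either side of an application; $\to_\beta$ is the contextual closure of $(\lambda[x:A]M)\cdot N\ \triangleright\ M[x:=N]$; $\simeq_\beta$ is the reflexive–symmetric–transitive closure of $\sim_\alpha\cup\to_\beta$. PTS: fix $\mathcal{A}\subseteq\mathcal{C}^2$ (axioms) and $\mathcal{R}\subseteq\mathcal{C}^3$ (rules). A context is a list of pairs $(x,A)$; $\Gamma,x:A$ denotes $(x,A)::\Gamma$; $\mathrm{dom}\,\Gamma$ is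 the list of first components. The judgments $\Gamma\ \mathrm{ok}$ and $\Gamma\vdash M:A$ are mutually inductively defined by: (nil) $[\,]\ \mathrm{ok}$; (cons) if $\Gamma\ \mathrm{ok}$, $\Gamma\vdash A:\mathsf{c}\,s$ and $x\notin\mathrm{dom}\,\Gamma$ then $(\Gamma,x:A)\ \mathrm{ok}$; (sort) if $\Gamma\ \mathrm{ok}$ and $\mathcal{A}\,s_1\,s_2$ then $\Gamma\vdash\mathsf{c}\,s_1:\mathsf{c}\,s_2$; (prod) if $\Gamma\vdash A:\mathsf{c}\,s_1$, for every $y\notin\mathrm{dom}\,\Gamma$ we have $\Gamma,y:A\vdash B[x:=\mathsf{v}\,y]:\mathsf{c}\,s_2$, and $\mathcal{R}\,s_1\,s_2\,s_3$, then $\Gamma\vdash\Pi[x:A]B:\mathsf{c}\,s_3$; (var) if $\Gamma\ \mathrm{ok}$ and $(x,A)\in\Gamma$ then $\Gamma\vdash\mathsf{v}\,x:A$; (abs) if $\Gamma\vdash A:\mathsf{c}\,s_1$, for every $z\notin\mathrm{dom}\,\Gamma$ both $\Gamma,z:A\vdash B[y:=\mathsf{v}\,z]:\mathsf{c}\,s_2$ and $\Gamma,z:A\vdash M[x:=\mathsf{v}\,z]:B[y:=\mathsf{v}\,z]$, and $\mathcal{R}\,s_1\,s_2\,s_3$, then $\Gamma\vdash\lambda[x:A]M:\Pi[y:A]B$; (app) if $\Gamma\vdash M:\Pi[x:A]B$, $\Gamma\vdash N:A$ and $\Gamma\vdash B[x:=N]:\mathsf{c}\,s$, then $\Gamma\vdash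 M\cdot N:B[x:=N]$; (conv) if $\Gamma\vdash M:A$, $A\simeq_\beta B$ and $\Gamma\vdash B:\mathsf{c}\,s$ then $\Gamma\vdash M:B$. -}

module Defs where

open import Data.Nat using (ℕ)
open import Data.List using (List; []; _∷_; _++_; map; concatMap; filter)
open import Data.List.Membership.Propositional using (_∈_; _∉_)
open import Data.Product using (_×_; _,_; proj₁)
open import Relation.Binary.PropositionalEquality using (_≡_)
open import Relation.Binary.Definitions using (DecidableEquality)
open import Relation.Nullary using (¬_; yes; no)
open import Relation.Nullary.Decidable using (¬?)
open import Level using (Level)

module PTS
  {ℓv ℓc ℓa ℓr : Level}
  (V : Set ℓv) (_≟V_ : DecidableEquality V)
  (encode : V → ℕ) (decode : ℕ → V)
  (encode-decode : ∀ n → encode (decode n) ≡ n)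
  (C : Set ℓc)
  (χ' : List ℕ → ℕ) (χ'-fresh : ∀ ns → χ' ns ∉ ns)
  (𝒜 : C → C → Set ℓa)
  (ℛ : C → C → C → Set ℓr)
  where

  data Term : Set (ℓv Level.⊔ ℓc) where
    c   : C → Term
    v   : V → Term
    lam : V → Term → Term → Term   -- λ[x:A]M  is  lam x A M
    pi  : V → Term → Term → Term   -- Π[x:A]B  is  pi x A B
    _·_ : Term → Term → Term

  _minus_ : List V → V → List V
  xs minus x = filter (λ y → ¬? (y ≟V x)) xs

  fv : Term → List V
  fv (c k) = []
  fv (v x) = x ∷ []
  fv (lam x A M) = fv A ++ (fv M minus x)
  fv (pi x A B) = fv A ++ (fv B minus x)
  fv (M · N) = fv M ++ fv N

  Subst : Set (ℓv Level.⊔ ℓc)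
  Subst = V → Term

  ι : Subst
  ι x = v x

  _,_:=_ : Subst → V → Term → Subst
  (σ , x := N) y with y ≟V x
  ... | yes _ = N
  ... | no  _ = σ y

  X' : List V → V
  X' xs = decode (χ' (map encode xs))

  X : Subst → List V → V
  X σ xs = X' (concatMap (λ y → fv (σ y)) xs)

  _∙_ : Term → Subst → Term
  c k ∙ σ = c k
  v x ∙ σ = σ x
  (M · N) ∙ σ = (M ∙ σ) · (N ∙ σ)
  lam x A M ∙ σ =
    let y = X σ (fv M minus x) in lam y (A ∙ σ) (M ∙ (σ , x := v y))
  pi x A B ∙ σ =
    let y = X σ (fv B minus x) in pi y (A ∙ σ) (B ∙ (σ , x := v y))

  _[_:=_] : Term → V → Term → Term
  M [ x := N ] = M ∙ (ι , x := N)

  data _∼α_ : Term → Term → Set (ℓv Level.⊔ ℓc) where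
    α-c   : ∀ k → c k ∼α c k
    α-v   : ∀ x → v x ∼α v x
    α-app : ∀ {M M' N N'} → M ∼α M' → N ∼α N' → (M · N) ∼α (M' · N')
    α-lam : ∀ {x x' A A' M M'} y → A ∼α A' →
            y ∉ (fv M minus x) → y ∉ (fv M' minus x') →
            M [ x := v y ] ≡ M' [ x' := v y ] →
            lam x A M ∼α lam x' A' M'
    α-pi  : ∀ {x x' A A' B B'} y → A ∼α A' →
            y ∉ (fv B minus x) → y ∉ (fv B' minus x') →
            B [ x := v y ] ≡ B' [ x' := v y ] →
            pi x A B ∼α pi x' A' B'

  data Ctx {ℓ} (S : Term → Term → Set ℓ) : Term → Term → Set (ℓv Level.⊔ ℓc Level.⊔ ℓ) where
    base    : ∀ {M N} → S M N → Ctx S M N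
    lam-body : ∀ {x A M M'} → Ctx S M M' → Ctx S (lam x A M) (lam x A M')
    lam-ann  : ∀ {x A A' M} → Ctx S A A' → Ctx S (lam x A M) (lam x A' M)
    pi-cod   : ∀ {x A B B'} → Ctx S B B' → Ctx S (pi x A B) (pi x A B')
    pi-dom   : ∀ {x A A' B} → Ctx S A A' → Ctx S (pi x A B) (pi x A' B)
    app-l    : ∀ {M M' N} → Ctx S M M' → Ctx S (M · N) (M' · N)
    app-r    : ∀ {M N N'} → Ctx S N N' → Ctx S (M · N) (M · N')

  data _▷β_ : Term → Term → Set (ℓv Level.⊔ ℓc) where
    beta : ∀ x A M N → (lam x A M · N) ▷β (M [ x := N ])

  _→β_ : Term → Term → Set (ℓv Level.⊔ ℓc)
  _→β_ = Ctx _▷β_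

  data _≃β_ : Term → Term → Set (ℓv Level.⊔ ℓc) where
    ≃-α     : ∀ {M N} → M ∼α N → M ≃β N
    ≃-β     : ∀ {M N} → M →β N → M ≃β N
    ≃-refl  : ∀ {M} → M ≃β M
    ≃-sym   : ∀ {M N} → M ≃β N → N ≃β M
    ≃-trans : ∀ {M N P} → M ≃β N → N ≃β P → M ≃β P

  Context : Set (ℓv Level.⊔ ℓc)
  Context = List (V × Term)

  -- Γ , x : A  is  (x , A) ∷ Γ
  dom : Context → List V
  dom = map proj₁

  data _ok : Context → Set (ℓv Level.⊔ ℓc Level.⊔ ℓa Level.⊔ ℓr)
  data _⊢_∶_ : Context → Term → Term → Set (ℓv Level.⊔ ℓc Level.⊔ ℓa Level.⊔ ℓr)

  data _ok where
    ok-nil  : [] ok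
    ok-cons : ∀ {Γ x A s} → Γ ok → Γ ⊢ A ∶ c s → x ∉ dom Γ → ((x , A) ∷ Γ) ok

  data _⊢_∶_ where
    t-sort : ∀ {Γ s₁ s₂} → Γ ok → 𝒜 s₁ s₂ → Γ ⊢ c s₁ ∶ c s₂
    t-prod : ∀ {Γ x A B s₁ s₂ s₃} → Γ ⊢ A ∶ c s₁ →
             (∀ y → y ∉ dom Γ → ((y , A) ∷ Γ) ⊢ B [ x := v y ] ∶ c s₂) →
             ℛ s₁ s₂ s₃ → Γ ⊢ pi x A B ∶ c s₃
    t-var  : ∀ {Γ x A} → Γ ok → (x , A) ∈ Γ → Γ ⊢ v x ∶ A
    t-abs  : ∀ {Γ x y A M B s₁ s₂ s₃} → Γ ⊢ A ∶ c s₁ →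
             (∀ z → z ∉ dom Γ → ((z , A) ∷ Γ) ⊢ B [ y := v z ] ∶ c s₂) →
             (∀ z → z ∉ dom Γ → ((z , A) ∷ Γ) ⊢ M [ x := v z ] ∶ (B [ y := v z ])) →
             ℛ s₁ s₂ s₃ → Γ ⊢ lam x A M ∶ pi y A B
    t-app  : ∀ {Γ M N x A B s} → Γ ⊢ M ∶ pi x A B → Γ ⊢ N ∶ A →
             Γ ⊢ B [ x := N ] ∶ c s → Γ ⊢ (M · N) ∶ (B [ x := N ])
    t-conv : ∀ {Γ M A B s} → Γ ⊢ M ∶ A → A ≃β B → Γ ⊢ B ∶ c s → Γ ⊢ M ∶ B

-- Renaming the head variable is an instance of a general renaming lemma: if Δ lists the
-- entries of Γ with each name z replaced by ρ z and each type T by an α-variant of T ∙ ⟨ ρ ⟩,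
-- then Γ ⊢ M ∶ A gives Δ ⊢ M ∙ ⟨ ρ ⟩ ∶ A ∙ ⟨ ρ ⟩.
-- A binder premise, which holds for every name outside dom Γ, is used at a name u₀ fresh for
-- everything in sight, and ρ is extended by u₀ ↦ u for the new bound name u. The conversion
-- rule needs ≃β to be stable under substitution, which rests on the composition law
-- (M ∙ σ) ∙ τ ≡ M ∙ (σ ⨟ τ). Because substitution chooses canonical bound names, M ∙ ι is a
-- canonical representative of the α-class of M, and equalities between such representatives
-- stand in for α-equivalence.

module Submission where

open import Defs
open import Data.Nat using (ℕ)
open import Data.List using (List; []; _∷_; _++_; map; concat; concatMap)
open import Data.List.Effectful using (module MonadProperties)
open import Data.List.Membership.Propositional using (_∈_; _∉_; lose)
open import Data.List.Membership.Propositional.Properties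
  using (∈-++⁺ˡ; ∈-++⁺ʳ; ∈-++⁻; ∈-map⁺; ∈-filter⁺; ∈-filter⁻; ∈-concatMap⁺)
open import Data.List.Properties
  using (++-identityʳ; concatMap-++; concatMap-pure; concatMap-cong; map-cong-local
        ; filter-++; filter-reject)
open import Data.List.Relation.Binary.Pointwise using (Pointwise; []; _∷_)
open import Data.List.Relation.Binary.Subset.Propositional using (_⊆_)
open import Data.List.Relation.Binary.Subset.Propositional.Properties using (map⁺; ∷⁺ʳ)
open import Data.List.Relation.Unary.All using (tabulate)
open import Data.List.Relation.Unary.Any using (here; there)
open import Data.Product using (_×_; _,_; proj₁; proj₂)
open import Data.Sum using (inj₁; inj₂)
open import Data.Empty using (⊥-elim)
open import Function using (id; _∘_)
open import Relation.Binary.PropositionalEquality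
open import Relation.Binary.Definitions using (DecidableEquality)
open import Relation.Nullary using (yes; no)
open import Relation.Nullary.Decidable using (¬?)
open import Level using (Level; _⊔_)

module PTS-Properties {ℓv ℓc ℓa ℓr : Level}
  (V : Set ℓv) (_≟V_ : DecidableEquality V)
  (encode : V → ℕ) (decode : ℕ → V)
  (encode-decode : ∀ n → encode (decode n) ≡ n)
  (C : Set ℓc)
  (χ' : List ℕ → ℕ) (χ'-fresh : ∀ ns → χ' ns ∉ ns)
  (𝒜 : C → C → Set ℓa)
  (ℛ : C → C → C → Set ℓr) where

  open PTS V _≟V_ encode decode encode-decode C χ' χ'-fresh 𝒜 ℛ

  X'-fresh : ∀ xs → X' xs ∉ xs
  X'-fresh xs p = χ'-fresh (map encode xs) (subst (_∈ map encode xs) (encode-decode _) (∈-map⁺ encode p))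

  ∉-++⁻ˡ : ∀ {z : V} xs {ys} → z ∉ xs ++ ys → z ∉ xs
  ∉-++⁻ˡ xs z∉ = z∉ ∘ ∈-++⁺ˡ

  ∉-++⁻ʳ : ∀ {z : V} xs {ys} → z ∉ xs ++ ys → z ∉ ys
  ∉-++⁻ʳ xs z∉ = z∉ ∘ ∈-++⁺ʳ xs

  ∈-minus⁺ : ∀ {z x} {xs : List V} → z ∈ xs → z ≢ x → z ∈ xs minus x
  ∈-minus⁺ {x = x} = ∈-filter⁺ (λ y → ¬? (y ≟V x))

  ∈-minus⁻ : ∀ {z x} {xs : List V} → z ∈ xs minus x → z ∈ xs × z ≢ x
  ∈-minus⁻ {x = x} = ∈-filter⁻ (λ y → ¬? (y ≟V x))

  ∉-minus : ∀ {z x} {xs : List V} → z ∉ xs → z ∉ xs minus x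
  ∉-minus z∉ = z∉ ∘ proj₁ ∘ ∈-minus⁻

  minus-∉ : ∀ {x} (xs : List V) → x ∉ xs → xs minus x ≡ xs
  minus-∉ [] _ = refl
  minus-∉ {x} (z ∷ xs) x∉ with z ≟V x
  ... | yes refl = ⊥-elim (x∉ (here refl))
  ... | no _ = cong (z ∷_) (minus-∉ xs (x∉ ∘ there))

  fv⟨_⟩ : Subst → List V → List V
  fv⟨ σ ⟩ = concatMap (λ y → fv (σ y))

  fv⟨⟩-cong : ∀ {σ τ} xs → (∀ {z} → z ∈ xs → fv (σ z) ≡ fv (τ z)) → fv⟨ σ ⟩ xs ≡ fv⟨ τ ⟩ xs
  fv⟨⟩-cong xs h = cong concat (map-cong-local (tabulate h))

  ∈-fv⟨⟩ : ∀ σ {z u xs} → z ∈ xs → u ∈ fv (σ z) → u ∈ fv⟨ σ ⟩ xs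
  ∈-fv⟨⟩ σ z∈ u∈ = ∈-concatMap⁺ (λ y → fv (σ y)) (lose z∈ u∈)

  _⨟_ : Subst → Subst → Subst
  (σ ⨟ τ) y = σ y ∙ τ

  ext-self : ∀ σ x N → (σ , x := N) x ≡ N
  ext-self σ x N with x ≟V x
  ... | yes _ = refl
  ... | no x≢x = ⊥-elim (x≢x refl)

  ext-other : ∀ σ {x y} N → y ≢ x → (σ , x := N) y ≡ σ y
  ext-other σ {x} {y} N y≢x with y ≟V x
  ... | yes y≡x = ⊥-elim (y≢x y≡x)
  ... | no _ = refl

  ext-⨟ : ∀ σ τ x N z → ((σ , x := N) ⨟ τ) z ≡ ((σ ⨟ τ) , x := (N ∙ τ)) z
  ext-⨟ σ τ x N z with z ≟V x
  ... | yes _ = refl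
  ... | no _ = refl

  -- The common shape of  lam x A M ∙ σ  and  pi x A M ∙ σ , so that their cases share one proof.
  binder-∙ : (V → Term → Term → Term) → V → Term → Term → Subst → Term
  binder-∙ b x A M σ = let y = X σ (fv M minus x) in b y (A ∙ σ) (M ∙ (σ , x := v y))

  cong-binder : ∀ (b : V → Term → Term → Term) {y y' A A' M M'} →
                y ≡ y' → A ≡ A' → M ≡ M' → b y A M ≡ b y' A' M'
  cong-binder b refl refl refl = refl

  ∙-cong : ∀ M {σ τ} → (∀ z → z ∈ fv M → σ z ≡ τ z) → M ∙ σ ≡ M ∙ τ
  binder-∙-cong : ∀ b x A M {σ τ} → (∀ z → z ∈ fv A ++ (fv M minus x) → σ z ≡ τ z) →
                  binder-∙ b x A M σ ≡ binder-∙ b x A M τ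

  ∙-cong (c k) h = refl
  ∙-cong (v x) h = h x (here refl)
  ∙-cong (M · N) h = cong₂ _·_ (∙-cong M (λ z → h z ∘ ∈-++⁺ˡ)) (∙-cong N (λ z → h z ∘ ∈-++⁺ʳ (fv M)))
  ∙-cong (lam x A M) = binder-∙-cong lam x A M
  ∙-cong (pi x A M) = binder-∙-cong pi x A M

  binder-∙-cong b x A M {σ} {τ} h =
    cong-binder b y-eq (∙-cong A (λ z → h z ∘ ∈-++⁺ˡ)) (∙-cong M body)
    where
      y-eq : X σ (fv M minus x) ≡ X τ (fv M minus x)
      y-eq = cong X' (fv⟨⟩-cong {σ} {τ} (fv M minus x) λ {z} z∈ → cong fv (h z (∈-++⁺ʳ (fv A) z∈)))
      body : ∀ z → z ∈ fv M → (σ , x := v (X σ (fv M minus x))) z ≡ (τ , x := v (X τ (fv M minus x))) z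
      body z z∈ with z ≟V x
      ... | yes _ = cong v y-eq
      ... | no z≢x = h z (∈-++⁺ʳ (fv A) (∈-minus⁺ z∈ z≢x))

  fv⟨⟩-ext : ∀ σ x w xs → w ∉ fv⟨ σ ⟩ (xs minus x) →
             fv⟨ σ , x := v w ⟩ xs minus w ≡ fv⟨ σ ⟩ (xs minus x)
  fv⟨⟩-ext σ x w [] _ = refl
  fv⟨⟩-ext σ x w (z ∷ xs) w∉ with z ≟V x
  ... | yes refl = trans (filter-reject (λ y → ¬? (y ≟V w)) (λ w≢w → w≢w refl)) (fv⟨⟩-ext σ z w xs w∉)
  ... | no _ = trans (filter-++ (λ y → ¬? (y ≟V w)) (fv (σ z)) _)
                     (cong₂ _++_ (minus-∉ (fv (σ z)) (∉-++⁻ˡ (fv (σ z)) w∉))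
                                 (fv⟨⟩-ext σ x w xs (∉-++⁻ʳ (fv (σ z)) w∉)))

  fv-∙ : ∀ M σ → fv (M ∙ σ) ≡ fv⟨ σ ⟩ (fv M)
  fv-∙-under : ∀ M σ x w → w ∉ fv⟨ σ ⟩ (fv M minus x) →
               fv (M ∙ (σ , x := v w)) minus w ≡ fv⟨ σ ⟩ (fv M minus x)

  fv-∙ (c k) σ = refl
  fv-∙ (v x) σ = sym (++-identityʳ _)
  fv-∙ (M · N) σ = trans (cong₂ _++_ (fv-∙ M σ) (fv-∙ N σ)) (sym (concatMap-++ _ (fv M) (fv N)))
  fv-∙ (lam x A M) σ =
    trans (cong₂ _++_ (fv-∙ A σ) (fv-∙-under M σ x _ (X'-fresh _))) (sym (concatMap-++ _ (fv A) _))
  fv-∙ (pi x A M) σ =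
    trans (cong₂ _++_ (fv-∙ A σ) (fv-∙-under M σ x _ (X'-fresh _))) (sym (concatMap-++ _ (fv A) _))

  fv-∙-under M σ x w w∉ = trans (cong (_minus w) (fv-∙ M _)) (fv⟨⟩-ext σ x w (fv M) w∉)

  ∈-fv-∙ : ∀ M σ {z u} → z ∈ fv M → u ∈ fv (σ z) → u ∈ fv (M ∙ σ)
  ∈-fv-∙ M σ z∈ u∈ = subst (_ ∈_) (sym (fv-∙ M σ)) (∈-fv⟨⟩ σ z∈ u∈)

  ∙-∙ : ∀ M σ τ → (M ∙ σ) ∙ τ ≡ M ∙ (σ ⨟ τ)
  binder-∙-∙ : ∀ b x A M σ τ → let w = X σ (fv M minus x) in
               binder-∙ b w (A ∙ σ) (M ∙ (σ , x := v w)) τ ≡ binder-∙ b x A M (σ ⨟ τ)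
  ∙-ext-fresh : ∀ M σ τ x w N → w ∉ fv⟨ σ ⟩ (fv M minus x) →
                (M ∙ (σ , x := v w)) ∙ (τ , w := N) ≡ M ∙ ((σ ⨟ τ) , x := N)

  ∙-∙ (c k) σ τ = refl
  ∙-∙ (v x) σ τ = refl
  ∙-∙ (M · N) σ τ = cong₂ _·_ (∙-∙ M σ τ) (∙-∙ N σ τ)
  ∙-∙ (lam x A M) = binder-∙-∙ lam x A M
  ∙-∙ (pi x A M) = binder-∙-∙ pi x A M

  binder-∙-∙ b x A M σ τ =
    cong-binder b y-eq (∙-∙ A σ τ)
      (trans (∙-ext-fresh M σ τ x w _ (X'-fresh _)) (cong (λ y → M ∙ ((σ ⨟ τ) , x := v y)) y-eq))
    where
      open ≡-Reasoning
      w = X σ (fv M minus x)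
      y-eq : X τ (fv (M ∙ (σ , x := v w)) minus w) ≡ X (σ ⨟ τ) (fv M minus x)
      y-eq = cong X' (begin
        fv⟨ τ ⟩ (fv (M ∙ (σ , x := v w)) minus w)
          ≡⟨ cong fv⟨ τ ⟩ (fv-∙-under M σ x w (X'-fresh _)) ⟩
        fv⟨ τ ⟩ (fv⟨ σ ⟩ (fv M minus x))
          ≡⟨ MonadProperties.associative (fv M minus x) _ _ ⟨
        concatMap (λ z → fv⟨ τ ⟩ (fv (σ z))) (fv M minus x)
          ≡⟨ concatMap-cong (λ z → sym (fv-∙ (σ z) τ)) (fv M minus x) ⟩
        fv⟨ σ ⨟ τ ⟩ (fv M minus x)
          ∎)

  ∙-ext-fresh M σ τ x w N w∉ = trans (∙-∙ M (σ , x := v w) (τ , w := N)) (∙-cong M pointwise)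
    where
      pointwise : ∀ z → z ∈ fv M → ((σ , x := v w) ⨟ (τ , w := N)) z ≡ ((σ ⨟ τ) , x := N) z
      pointwise z z∈ with z ≟V x
      ... | yes _ = ext-self τ w N
      ... | no z≢x = ∙-cong (σ z) λ u u∈ → ext-other τ N λ { refl → w∉ (∈-fv⟨⟩ σ (∈-minus⁺ z∈ z≢x) u∈) }

  ∙ι-idem : ∀ M → (M ∙ ι) ∙ ι ≡ M ∙ ι
  ∙ι-idem M = ∙-∙ M ι ι

  fv⟨ι⟩ : ∀ xs → fv⟨ ι ⟩ xs ≡ xs
  fv⟨ι⟩ = concatMap-pure

  [:=]-∙ : ∀ M x N σ → (M [ x := N ]) ∙ σ ≡ M ∙ (σ , x := (N ∙ σ))
  [:=]-∙ M x N σ = trans (∙-∙ M (ι , x := N) σ) (∙-cong M λ z _ → ext-⨟ ι σ x N z)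

  rename-∙ : ∀ M x y σ N → y ∉ fv M minus x → (M [ x := v y ]) ∙ (σ , y := N) ≡ M ∙ (σ , x := N)
  rename-∙ M x y σ N y∉ = ∙-ext-fresh M ι σ x y N (subst (y ∉_) (sym (fv⟨ι⟩ _)) y∉)

  fv-rename : ∀ M x y → y ∉ fv M minus x → fv (M [ x := v y ]) minus y ≡ fv M minus x
  fv-rename M x y y∉ = trans (fv-∙-under M ι x y (subst (y ∉_) (sym (fv⟨ι⟩ _)) y∉)) (fv⟨ι⟩ _)

  ∼α⇒∙≡ : ∀ {M N} → M ∼α N → ∀ σ → M ∙ σ ≡ N ∙ σ
  binder-∙-∼α : ∀ b {x x' A A' M M'} y → A ∼α A' → y ∉ fv M minus x → y ∉ fv M' minus x' →
                M [ x := v y ] ≡ M' [ x' := v y ] → ∀ σ → binder-∙ b x A M σ ≡ binder-∙ b x' A' M' σ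

  ∼α⇒∙≡ (α-c k) σ = refl
  ∼α⇒∙≡ (α-v x) σ = refl
  ∼α⇒∙≡ (α-app M∼M' N∼N') σ = cong₂ _·_ (∼α⇒∙≡ M∼M' σ) (∼α⇒∙≡ N∼N' σ)
  ∼α⇒∙≡ (α-lam {x} {x'} {A} {A'} {M} {M'} y A∼A' y∉M y∉M' M≡M') =
    binder-∙-∼α lam {x} {x'} {A} {A'} {M} {M'} y A∼A' y∉M y∉M' M≡M'
  ∼α⇒∙≡ (α-pi {x} {x'} {A} {A'} {B} {B'} y A∼A' y∉B y∉B' B≡B') =
    binder-∙-∼α pi {x} {x'} {A} {A'} {B} {B'} y A∼A' y∉B y∉B' B≡B'

  binder-∙-∼α b {x} {x'} {A} {A'} {M} {M'} y A∼A' y∉M y∉M' M≡M' σ =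
    cong-binder b w≡w' (∼α⇒∙≡ A∼A' σ) (begin
      M ∙ (σ , x := v w)                 ≡⟨ rename-∙ M x y σ (v w) y∉M ⟨
      (M [ x := v y ]) ∙ (σ , y := v w)   ≡⟨ cong (_∙ (σ , y := v w)) M≡M' ⟩
      (M' [ x' := v y ]) ∙ (σ , y := v w) ≡⟨ rename-∙ M' x' y σ (v w) y∉M' ⟩
      M' ∙ (σ , x' := v w)               ≡⟨ cong (λ u → M' ∙ (σ , x' := v u)) w≡w' ⟩
      M' ∙ (σ , x' := v w')              ∎)
    where
      open ≡-Reasoning
      w = X σ (fv M minus x)
      w' = X σ (fv M' minus x')
      w≡w' : w ≡ w'
      w≡w' = cong (X σ) (begin
        fv M minus x                   ≡⟨ fv-rename M x y y∉M ⟨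
        fv (M [ x := v y ]) minus y    ≡⟨ cong (λ T → fv T minus y) M≡M' ⟩
        fv (M' [ x' := v y ]) minus y  ≡⟨ fv-rename M' x' y y∉M' ⟩
        fv M' minus x'                 ∎)

  AlphaRule : (V → Term → Term → Term) → Set (ℓv ⊔ ℓc)
  AlphaRule b = ∀ {x x' A A' M M'} y → A ∼α A' → y ∉ fv M minus x → y ∉ fv M' minus x' →
                M [ x := v y ] ≡ M' [ x' := v y ] → b x A M ∼α b x' A' M'

  ∼α-annot : ∀ {b} → AlphaRule b → ∀ {x A A' M} → A ∼α A' → b x A M ∼α b x A' M
  ∼α-annot α-b {x} {A} {A'} {M} A∼A' =
    α-b {x} {x} {A} {A'} {M} {M} (X' (fv M)) A∼A' (∉-minus (X'-fresh _)) (∉-minus (X'-fresh _)) refl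

  α-refl : ∀ M → M ∼α M
  α-refl (c k) = α-c k
  α-refl (v x) = α-v x
  α-refl (M · N) = α-app (α-refl M) (α-refl N)
  α-refl (lam x A M) = ∼α-annot {lam} α-lam (α-refl A)
  α-refl (pi x A M) = ∼α-annot {pi} α-pi (α-refl A)

  ∼α-body : ∀ {b} → AlphaRule b → ∀ {x A M M'} → M ∼α M' → b x A M ∼α b x A M'
  ∼α-body α-b {x} {A} {M} {M'} M∼M' =
    α-b {x} {x} {A} {A} {M} {M'} (X' (fv M ++ fv M')) (α-refl A)
      (∉-minus (∉-++⁻ˡ (fv M) (X'-fresh _))) (∉-minus (∉-++⁻ʳ (fv M) (X'-fresh _))) (∼α⇒∙≡ M∼M' _)

  binder-∼α-∙ι : ∀ {b} → AlphaRule b → ∀ x A M → A ∼α (A ∙ ι) → b x A M ∼α binder-∙ b x A M ι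
  binder-∼α-∙ι α-b x A M A∼A∙ι =
    α-b {x} {w} {A} {A ∙ ι} {M} {M ∙ (ι , x := v w)} w A∼A∙ι
      (subst (w ∉_) (fv⟨ι⟩ _) w∉) (subst (w ∉_) (sym (fv-∙-under M ι x w w∉)) w∉)
      (sym (∙-ext-fresh M ι ι x w (v w) w∉))
    where
      w = X ι (fv M minus x)
      w∉ : w ∉ fv⟨ ι ⟩ (fv M minus x)
      w∉ = X'-fresh _

  ∼α-∙ι : ∀ M → M ∼α (M ∙ ι)
  ∼α-∙ι (c k) = α-c k
  ∼α-∙ι (v x) = α-v x
  ∼α-∙ι (M · N) = α-app (∼α-∙ι M) (∼α-∙ι N)
  ∼α-∙ι (lam x A M) = binder-∼α-∙ι {lam} α-lam x A M (∼α-∙ι A)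
  ∼α-∙ι (pi x A M) = binder-∼α-∙ι {pi} α-pi x A M (∼α-∙ι A)

  ≃β-∙ι : ∀ {M N} → M ∙ ι ≡ N ∙ ι → M ≃β N
  ≃β-∙ι {M} {N} M≡N = ≃-trans (≃-α (∼α-∙ι M)) (subst (_≃β N) (sym M≡N) (≃-sym (≃-α (∼α-∙ι N))))

  ∙-≃β : ∀ M {σ τ} → (∀ z → z ∈ fv M → σ z ∙ ι ≡ τ z ∙ ι) → (M ∙ σ) ≃β (M ∙ τ)
  ∙-≃β M {σ} {τ} h = ≃β-∙ι (trans (∙-∙ M σ ι) (trans (∙-cong M h) (sym (∙-∙ M τ ι))))

  ≃β-cong : ∀ (F : Term → Term) → (∀ {M N} → M ∼α N → F M ∼α F N) →
            (∀ {M N} → M →β N → F M →β F N) → ∀ {M N} → M ≃β N → F M ≃β F N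
  ≃β-cong F α-F β-F (≃-α M∼N) = ≃-α (α-F M∼N)
  ≃β-cong F α-F β-F (≃-β M→N) = ≃-β (β-F M→N)
  ≃β-cong F α-F β-F ≃-refl = ≃-refl
  ≃β-cong F α-F β-F (≃-sym N≃M) = ≃-sym (≃β-cong F α-F β-F N≃M)
  ≃β-cong F α-F β-F (≃-trans M≃P P≃N) = ≃-trans (≃β-cong F α-F β-F M≃P) (≃β-cong F α-F β-F P≃N)

  binder-rename : ∀ {b} → AlphaRule b → ∀ σ x A M {w w'} →
                  w ∉ fv⟨ σ ⟩ (fv M minus x) → w' ∉ fv⟨ σ ⟩ (fv M minus x) →
                  b w A (M ∙ (σ , x := v w)) ∼α b w' A (M ∙ (σ , x := v w'))
  binder-rename α-b σ x A M {w} {w'} w∉ w'∉ =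
    α-b {w} {w'} {A} {A} {M ∙ (σ , x := v w)} {M ∙ (σ , x := v w')} y (α-refl A) (y∉ w∉) (y∉ w'∉)
      (trans (∙-ext-fresh M σ ι x w (v y) w∉) (sym (∙-ext-fresh M σ ι x w' (v y) w'∉)))
    where
      y = X σ (fv M minus x)
      y∉ : ∀ {u} → u ∉ fv⟨ σ ⟩ (fv M minus x) → y ∉ fv (M ∙ (σ , x := v u)) minus u
      y∉ {u} u∉ = subst (y ∉_) (sym (fv-∙-under M σ x u u∉)) (X'-fresh _)

  binder-∙-≃β : ∀ {b} → AlphaRule b → (∀ {x A M M'} → M →β M' → b x A M →β b x A M') →
                ∀ x A M M' σ → (∀ τ → (M ∙ τ) ≃β (M' ∙ τ)) → binder-∙ b x A M σ ≃β binder-∙ b x A M' σ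
  binder-∙-≃β {b} α-b β-b x A M M' σ M≃M' =
    ≃-trans (≃-α (binder-rename {b} α-b σ x (A ∙ σ) M (X'-fresh _) (∉-++⁻ˡ _ u∉)))
      (≃-trans (≃β-cong (b u (A ∙ σ)) (∼α-body {b} α-b) β-b (M≃M' (σ , x := v u)))
        (≃-sym (≃-α (binder-rename {b} α-b σ x (A ∙ σ) M' (X'-fresh _) (∉-++⁻ʳ _ u∉)))))
    where
      u = X' (fv⟨ σ ⟩ (fv M minus x) ++ fv⟨ σ ⟩ (fv M' minus x))
      u∉ : u ∉ fv⟨ σ ⟩ (fv M minus x) ++ fv⟨ σ ⟩ (fv M' minus x)
      u∉ = X'-fresh _

  →β-∙ : ∀ {M N} → M →β N → ∀ σ → (M ∙ σ) ≃β (N ∙ σ)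
  →β-∙ (base (beta x A M N)) σ =
    ≃-trans (≃-β (base (beta _ _ _ _)))
      (subst₂ _≃β_ (sym (∙-ext-fresh M σ ι x _ (N ∙ σ) (X'-fresh _))) (sym ([:=]-∙ M x N σ))
        (∙-≃β M ι-equal))
    where
      ι-equal : ∀ z → z ∈ fv M → ((σ ⨟ ι) , x := (N ∙ σ)) z ∙ ι ≡ (σ , x := (N ∙ σ)) z ∙ ι
      ι-equal z _ with z ≟V x
      ... | yes _ = refl
      ... | no _ = ∙ι-idem (σ z)
  →β-∙ (lam-body {x} {A} {M} {M'} M→M') σ = binder-∙-≃β {lam} α-lam lam-body x A M M' σ (→β-∙ M→M')
  →β-∙ (pi-cod {x} {A} {B} {B'} B→B') σ = binder-∙-≃β {pi} α-pi pi-cod x A B B' σ (→β-∙ B→B')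
  →β-∙ (lam-ann A→A') σ = ≃β-cong (λ A → lam _ A _) (∼α-annot {lam} α-lam) lam-ann (→β-∙ A→A' σ)
  →β-∙ (pi-dom A→A') σ = ≃β-cong (λ A → pi _ A _) (∼α-annot {pi} α-pi) pi-dom (→β-∙ A→A' σ)
  →β-∙ (app-l M→M') σ = ≃β-cong (_· _) (λ M∼M' → α-app M∼M' (α-refl _)) app-l (→β-∙ M→M' σ)
  →β-∙ (app-r N→N') σ = ≃β-cong (_ ·_) (α-app (α-refl _)) app-r (→β-∙ N→N' σ)

  ≃β-∙ : ∀ {M N} → M ≃β N → ∀ σ → (M ∙ σ) ≃β (N ∙ σ)
  ≃β-∙ (≃-α M∼N) σ = subst (_ ≃β_) (∼α⇒∙≡ M∼N σ) ≃-refl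
  ≃β-∙ (≃-β M→N) σ = →β-∙ M→N σ
  ≃β-∙ ≃-refl σ = ≃-refl
  ≃β-∙ (≃-sym N≃M) σ = ≃-sym (≃β-∙ N≃M σ)
  ≃β-∙ (≃-trans M≃P P≃N) σ = ≃-trans (≃β-∙ M≃P σ) (≃β-∙ P≃N σ)

  ⊢⇒ok : ∀ {Γ M A} → Γ ⊢ M ∶ A → Γ ok
  ⊢⇒ok (t-sort Γ-ok _) = Γ-ok
  ⊢⇒ok (t-var Γ-ok _) = Γ-ok
  ⊢⇒ok (t-prod ⊢A _ _) = ⊢⇒ok ⊢A
  ⊢⇒ok (t-abs ⊢A _ _ _) = ⊢⇒ok ⊢A
  ⊢⇒ok (t-app ⊢M _ _) = ⊢⇒ok ⊢M
  ⊢⇒ok (t-conv ⊢M _ _) = ⊢⇒ok ⊢M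

  ⊢-weaken : ∀ {Γ Γ' M A} → Γ ⊢ M ∶ A → Γ ⊆ Γ' → Γ' ok → Γ' ⊢ M ∶ A
  ⊢-weaken (t-sort _ s₁s₂) Γ⊆Γ' Γ'-ok = t-sort Γ'-ok s₁s₂
  ⊢-weaken (t-var _ x∈Γ) Γ⊆Γ' Γ'-ok = t-var Γ'-ok (Γ⊆Γ' x∈Γ)
  ⊢-weaken (t-prod ⊢A ⊢B r) Γ⊆Γ' Γ'-ok =
    t-prod ⊢A' (λ u u∉ → ⊢-weaken (⊢B u (u∉ ∘ map⁺ proj₁ Γ⊆Γ')) (∷⁺ʳ _ Γ⊆Γ') (ok-cons Γ'-ok ⊢A' u∉)) r
    where ⊢A' = ⊢-weaken ⊢A Γ⊆Γ' Γ'-ok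
  ⊢-weaken (t-abs ⊢A ⊢B ⊢M r) Γ⊆Γ' Γ'-ok =
    t-abs ⊢A' (λ u u∉ → ⊢-weaken (⊢B u (u∉ ∘ map⁺ proj₁ Γ⊆Γ')) (∷⁺ʳ _ Γ⊆Γ') (ok-cons Γ'-ok ⊢A' u∉))
              (λ u u∉ → ⊢-weaken (⊢M u (u∉ ∘ map⁺ proj₁ Γ⊆Γ')) (∷⁺ʳ _ Γ⊆Γ') (ok-cons Γ'-ok ⊢A' u∉)) r
    where ⊢A' = ⊢-weaken ⊢A Γ⊆Γ' Γ'-ok
  ⊢-weaken (t-app ⊢M ⊢N ⊢B) Γ⊆Γ' Γ'-ok =
    t-app (⊢-weaken ⊢M Γ⊆Γ' Γ'-ok) (⊢-weaken ⊢N Γ⊆Γ' Γ'-ok) (⊢-weaken ⊢B Γ⊆Γ' Γ'-ok)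
  ⊢-weaken (t-conv ⊢M A≃B ⊢B) Γ⊆Γ' Γ'-ok =
    t-conv (⊢-weaken ⊢M Γ⊆Γ' Γ'-ok) A≃B (⊢-weaken ⊢B Γ⊆Γ' Γ'-ok)

  body-fv⊆dom : ∀ Γ M x → (∀ u → u ∉ dom Γ → fv (M [ x := v u ]) ⊆ u ∷ dom Γ) → fv M minus x ⊆ dom Γ
  body-fv⊆dom Γ M x fv⊆ {z} z∈ =
    drop-u (fv⊆ u (∉-++⁻ˡ (dom Γ) u∉) (∈-fv-∙ M (ι , x := v u) z∈M z∈[x:=u]z))
    where
      u = X' (dom Γ ++ fv M)
      u∉ = X'-fresh (dom Γ ++ fv M)
      z∈M = proj₁ (∈-minus⁻ {xs = fv M} z∈)
      z≢x = proj₂ (∈-minus⁻ {xs = fv M} z∈)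
      z∈[x:=u]z : z ∈ fv ((ι , x := v u) z)
      z∈[x:=u]z = subst (λ T → z ∈ fv T) (sym (ext-other ι (v u) z≢x)) (here refl)
      drop-u : z ∈ u ∷ dom Γ → z ∈ dom Γ
      drop-u (here z≡u) = ⊥-elim (∉-++⁻ʳ (dom Γ) u∉ (subst (_∈ fv M) z≡u z∈M))
      drop-u (there z∈Γ) = z∈Γ

  ⊢-fv⊆dom : ∀ {Γ M A} → Γ ⊢ M ∶ A → fv M ⊆ dom Γ
  ⊢-fv⊆dom (t-sort _ _) ()
  ⊢-fv⊆dom (t-var _ x∈Γ) (here refl) = ∈-map⁺ proj₁ x∈Γ
  ⊢-fv⊆dom (t-prod {Γ} {x} {A} {B} ⊢A ⊢B _) z∈ with ∈-++⁻ (fv A) z∈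
  ... | inj₁ z∈A = ⊢-fv⊆dom ⊢A z∈A
  ... | inj₂ z∈B = body-fv⊆dom Γ B x (λ u u∉ → ⊢-fv⊆dom (⊢B u u∉)) z∈B
  ⊢-fv⊆dom (t-abs {Γ} {x} {A = A} {M} ⊢A _ ⊢M _) z∈ with ∈-++⁻ (fv A) z∈
  ... | inj₁ z∈A = ⊢-fv⊆dom ⊢A z∈A
  ... | inj₂ z∈M = body-fv⊆dom Γ M x (λ u u∉ → ⊢-fv⊆dom (⊢M u u∉)) z∈M
  ⊢-fv⊆dom (t-app {M = M} ⊢M ⊢N _) z∈ with ∈-++⁻ (fv M) z∈
  ... | inj₁ z∈M = ⊢-fv⊆dom ⊢M z∈M
  ... | inj₂ z∈N = ⊢-fv⊆dom ⊢N z∈N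
  ⊢-fv⊆dom (t-conv ⊢M _ _) = ⊢-fv⊆dom ⊢M

  ⟨_⟩ : (V → V) → Subst
  ⟨ ρ ⟩ z = v (ρ z)

  _[_↦_] : (V → V) → V → V → V → V
  (ρ [ a ↦ b ]) z with z ≟V a
  ... | yes _ = b
  ... | no _ = ρ z

  ↦-self : ∀ ρ a b → (ρ [ a ↦ b ]) a ≡ b
  ↦-self ρ a b with a ≟V a
  ... | yes _ = refl
  ... | no a≢a = ⊥-elim (a≢a refl)

  ↦-∉ : ∀ ρ {a} b {z} {xs : List V} → a ∉ xs → z ∈ xs → (ρ [ a ↦ b ]) z ≡ ρ z
  ↦-∉ ρ {a} b {z} a∉ z∈ with z ≟V a
  ... | yes refl = ⊥-elim (a∉ z∈)
  ... | no _ = refl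

  ⟨↦⟩ : ∀ ρ a b z → ⟨ ρ [ a ↦ b ] ⟩ z ≡ (⟨ ρ ⟩ , a := v b) z
  ⟨↦⟩ ρ a b z with z ≟V a
  ... | yes _ = refl
  ... | no _ = refl

  vars : Context → List V
  vars [] = []
  vars ((z , T) ∷ Γ) = z ∷ fv T ++ vars Γ

  dom⊆vars : ∀ Γ → dom Γ ⊆ vars Γ
  dom⊆vars ((z , T) ∷ Γ) (here z≡) = here z≡
  dom⊆vars ((z , T) ∷ Γ) (there u∈) = there (∈-++⁺ʳ (fv T) (dom⊆vars Γ u∈))

  -- Types only up to α: renaming does not commute syntactically with the bound names chosen by X.
  RenamedEntry : (V → V) → V × Term → V × Term → Set (ℓv ⊔ ℓc)
  RenamedEntry ρ (z' , T') (z , T) = z' ≡ ρ z × T' ∙ ι ≡ (T ∙ ⟨ ρ ⟩) ∙ ι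

  Renamed : (V → V) → Context → Context → Set (ℓv ⊔ ℓc)
  Renamed ρ = Pointwise (RenamedEntry ρ)

  Renamed-cong : ∀ {ρ ρ' Δ Γ} → Renamed ρ Δ Γ → (∀ z → z ∈ vars Γ → ρ z ≡ ρ' z) → Renamed ρ' Δ Γ
  Renamed-cong [] _ = []
  Renamed-cong {Γ = (z , T) ∷ Γ} ((z'≡ρz , T'≡Tρ) ∷ Δ~Γ) ρ≡ρ' =
    (trans z'≡ρz (ρ≡ρ' z (here refl)) ,
     trans T'≡Tρ (cong (_∙ ι) (∙-cong T λ u u∈ → cong v (ρ≡ρ' u (there (∈-++⁺ˡ u∈)))))) ∷
    Renamed-cong Δ~Γ (λ u u∈ → ρ≡ρ' u (there (∈-++⁺ʳ (fv T) u∈)))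

  Renamed-∷ : ∀ {ρ Δ Γ A} u₀ u → Renamed ρ Δ Γ → u₀ ∉ vars Γ → u₀ ∉ fv A →
              Renamed (ρ [ u₀ ↦ u ]) ((u , A ∙ ⟨ ρ ⟩) ∷ Δ) ((u₀ , A) ∷ Γ)
  Renamed-∷ {ρ} {A = A} u₀ u Δ~Γ u₀∉Γ u₀∉A =
    (sym (↦-self ρ u₀ u) , cong (_∙ ι) (∙-cong A λ z z∈ → cong v (sym (↦-∉ ρ u u₀∉A z∈)))) ∷
    Renamed-cong Δ~Γ (λ z z∈ → sym (↦-∉ ρ u u₀∉Γ z∈))

  ∙-fixed : ∀ {ρ} T → (∀ z → z ∈ fv T → ρ z ≡ z) → T ∙ ι ≡ (T ∙ ⟨ ρ ⟩) ∙ ι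
  ∙-fixed T fixed = trans (sym (∙ι-idem T)) (cong (_∙ ι) (∙-cong T λ z z∈ → cong v (sym (fixed z z∈))))

  Renamed-fixed : ∀ {ρ Γ} → Γ ok → (∀ z → z ∈ dom Γ → ρ z ≡ z) → Renamed ρ Γ Γ
  Renamed-fixed ok-nil _ = []
  Renamed-fixed (ok-cons {x = z} {A = T} Γ-ok ⊢T _) fixed =
    (sym (fixed z (here refl)) , ∙-fixed T (λ u u∈ → fixed u (there (⊢-fv⊆dom ⊢T u∈)))) ∷
    Renamed-fixed Γ-ok (λ u → fixed u ∘ there)

  -- The body of  binder-∙ b x A P σ  instantiated at u, as in the premises of t-prod and t-abs.
  open-∙ : Term → V → Subst → V → Term
  open-∙ P x σ u = let w = X σ (fv P minus x) in (P ∙ (σ , x := v w)) [ w := v u ]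

  open-∙-↦ : ∀ ρ P x u₀ u → u₀ ∉ fv P minus x → (P [ x := v u₀ ]) ∙ ⟨ ρ [ u₀ ↦ u ] ⟩ ≡ open-∙ P x ⟨ ρ ⟩ u
  open-∙-↦ ρ P x u₀ u u₀∉ = begin
    (P [ x := v u₀ ]) ∙ ⟨ ρ [ u₀ ↦ u ] ⟩     ≡⟨ ∙-cong (P [ x := v u₀ ]) (λ z _ → ⟨↦⟩ ρ u₀ u z) ⟩
    (P [ x := v u₀ ]) ∙ (⟨ ρ ⟩ , u₀ := v u)  ≡⟨ rename-∙ P x u₀ ⟨ ρ ⟩ (v u) u₀∉ ⟩
    P ∙ (⟨ ρ ⟩ , x := v u)                   ≡⟨ ∙-ext-fresh P ⟨ ρ ⟩ ι x _ (v u) (X'-fresh _) ⟨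
    open-∙ P x ⟨ ρ ⟩ u                       ∎
    where open ≡-Reasoning

  [:=]-∙⟨⟩ : ∀ B x N ρ → let w = X ⟨ ρ ⟩ (fv B minus x) in
             (B ∙ (⟨ ρ ⟩ , x := v w)) [ w := N ∙ ⟨ ρ ⟩ ] ≡ (B [ x := N ]) ∙ ⟨ ρ ⟩
  [:=]-∙⟨⟩ B x N ρ =
    trans (∙-ext-fresh B ⟨ ρ ⟩ ι x _ (N ∙ ⟨ ρ ⟩) (X'-fresh _)) (sym ([:=]-∙ B x N ⟨ ρ ⟩))

  ⊢-rename : ∀ {Γ M A} → Γ ⊢ M ∶ A → ∀ ρ {Δ} → Renamed ρ Δ Γ → Δ ok → Δ ⊢ M ∙ ⟨ ρ ⟩ ∶ (A ∙ ⟨ ρ ⟩)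
  ⊢-rename-var : ∀ {Γ z T} → Γ ok → (z , T) ∈ Γ → ∀ ρ {Δ} → Renamed ρ Δ Γ → Δ ok →
                 Δ ⊢ v (ρ z) ∶ (T ∙ ⟨ ρ ⟩)
  ⊢-rename-body : ∀ {Γ Δ A s} ρ x P y Q → Renamed ρ Δ Γ → Δ ⊢ A ∙ ⟨ ρ ⟩ ∶ c s →
                  (∀ u₀ → u₀ ∉ dom Γ → ∀ ρ' {Δ'} → Renamed ρ' Δ' ((u₀ , A) ∷ Γ) → Δ' ok →
                     Δ' ⊢ (P [ x := v u₀ ]) ∙ ⟨ ρ' ⟩ ∶ ((Q [ y := v u₀ ]) ∙ ⟨ ρ' ⟩)) →
                  ∀ u → u ∉ dom Δ → ((u , A ∙ ⟨ ρ ⟩) ∷ Δ) ⊢ open-∙ P x ⟨ ρ ⟩ u ∶ open-∙ Q y ⟨ ρ ⟩ u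

  ⊢-rename (t-sort _ s₁s₂) ρ Δ~Γ Δ-ok = t-sort Δ-ok s₁s₂
  ⊢-rename (t-var Γ-ok z∈Γ) = ⊢-rename-var Γ-ok z∈Γ
  ⊢-rename (t-prod {x = x} {B = B} {s₂ = s₂} ⊢A ⊢B r) ρ Δ~Γ Δ-ok =
    t-prod ⊢A' (⊢-rename-body ρ x B x (c s₂) Δ~Γ ⊢A' (λ u₀ u₀∉ → ⊢-rename (⊢B u₀ u₀∉))) r
    where ⊢A' = ⊢-rename ⊢A ρ Δ~Γ Δ-ok
  ⊢-rename (t-abs {x = x} {y} {M = M} {B} {s₂ = s₂} ⊢A ⊢B ⊢M r) ρ Δ~Γ Δ-ok =
    t-abs ⊢A' (⊢-rename-body ρ y B y (c s₂) Δ~Γ ⊢A' (λ u₀ u₀∉ → ⊢-rename (⊢B u₀ u₀∉)))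
              (⊢-rename-body ρ x M y B Δ~Γ ⊢A' (λ u₀ u₀∉ → ⊢-rename (⊢M u₀ u₀∉))) r
    where ⊢A' = ⊢-rename ⊢A ρ Δ~Γ Δ-ok
  ⊢-rename (t-app {M = M} {N} {x} {B = B} {s} ⊢M ⊢N ⊢B) ρ {Δ} Δ~Γ Δ-ok =
    subst (λ T → Δ ⊢ (M ∙ ⟨ ρ ⟩) · (N ∙ ⟨ ρ ⟩) ∶ T) open-app-eq
      (t-app (⊢-rename ⊢M ρ Δ~Γ Δ-ok) (⊢-rename ⊢N ρ Δ~Γ Δ-ok)
        (subst (λ T → Δ ⊢ T ∶ c s) (sym open-app-eq) (⊢-rename ⊢B ρ Δ~Γ Δ-ok)))
    where open-app-eq = [:=]-∙⟨⟩ B x N ρ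
  ⊢-rename (t-conv ⊢M A≃B ⊢B) ρ Δ~Γ Δ-ok =
    t-conv (⊢-rename ⊢M ρ Δ~Γ Δ-ok) (≃β-∙ A≃B ⟨ ρ ⟩) (⊢-rename ⊢B ρ Δ~Γ Δ-ok)

  ⊢-rename-var (ok-cons Γ-ok ⊢T _) (here refl) ρ ((refl , T'≡Tρ) ∷ Δ~Γ) Δ-ok@(ok-cons Δ'-ok _ _) =
    t-conv (t-var Δ-ok (here refl)) (≃β-∙ι T'≡Tρ) (⊢-weaken (⊢-rename ⊢T ρ Δ~Γ Δ'-ok) there Δ-ok)
  ⊢-rename-var (ok-cons Γ-ok _ _) (there z∈Γ) ρ (_ ∷ Δ~Γ) Δ-ok@(ok-cons Δ'-ok _ _) =
    ⊢-weaken (⊢-rename-var Γ-ok z∈Γ ρ Δ~Γ Δ'-ok) there Δ-ok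

  ⊢-rename-body {Γ} {Δ} {A} ρ x P y Q Δ~Γ ⊢A' ⊢-rename-premise u u∉Δ =
    subst₂ (λ M T → ((u , A ∙ ⟨ ρ ⟩) ∷ Δ) ⊢ M ∶ T)
      (open-∙-↦ ρ P x u₀ u (∉-++⁻ˡ (fv P minus x) u₀∉PQ))
      (open-∙-↦ ρ Q y u₀ u (∉-++⁻ʳ (fv P minus x) u₀∉PQ))
      (⊢-rename-premise u₀ (u₀∉Γ ∘ dom⊆vars Γ) (ρ [ u₀ ↦ u ]) (Renamed-∷ u₀ u Δ~Γ u₀∉Γ u₀∉A)
        (ok-cons (⊢⇒ok ⊢A') ⊢A' u∉Δ))
    where
      -- u₀ is fresh for everything in sight, so ρ [ u₀ ↦ u ] still renames Γ, A, P and Q along ρ.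
      u₀ = X' (vars Γ ++ fv A ++ (fv P minus x) ++ (fv Q minus y))
      u₀∉ = X'-fresh (vars Γ ++ fv A ++ (fv P minus x) ++ (fv Q minus y))
      u₀∉Γ = ∉-++⁻ˡ (vars Γ) u₀∉
      u₀∉A = ∉-++⁻ˡ (fv A) (∉-++⁻ʳ (vars Γ) u₀∉)
      u₀∉PQ = ∉-++⁻ʳ (fv A) (∉-++⁻ʳ (vars Γ) u₀∉)

  ⊢-rename-head : ∀ Γ x y A M B → y ∉ dom Γ → ((x , A) ∷ Γ) ⊢ M ∶ B →
                  ((y , A) ∷ Γ) ⊢ M [ x := v y ] ∶ (B [ x := v y ])
  ⊢-rename-head Γ x y A M B y∉Γ ⊢M with ⊢⇒ok ⊢M
  ... | ok-cons Γ-ok ⊢A x∉Γ =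
    subst₂ (λ N T → ((y , A) ∷ Γ) ⊢ N ∶ T) (∙-cong M (λ z _ → ⟨ρ⟩≗ z)) (∙-cong B (λ z _ → ⟨ρ⟩≗ z))
      (⊢-rename ⊢M ρ renamed (ok-cons Γ-ok ⊢A y∉Γ))
    where
      ρ = id [ x ↦ y ]
      ⟨ρ⟩≗ : ∀ z → ⟨ ρ ⟩ z ≡ (ι , x := v y) z
      ⟨ρ⟩≗ = ⟨↦⟩ id x y
      fixed : ∀ z → z ∈ dom Γ → ρ z ≡ z
      fixed z = ↦-∉ id y x∉Γ
      renamed : Renamed ρ ((y , A) ∷ Γ) ((x , A) ∷ Γ)
      renamed = (sym (↦-self id x y) , ∙-fixed A (λ z → fixed z ∘ ⊢-fv⊆dom ⊢A)) ∷ Renamed-fixed Γ-ok fixed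

lemma23 : ∀ {ℓv ℓc ℓa ℓr : Level}
    (V : Set ℓv) (_≟V_ : DecidableEquality V)
    (encode : V → ℕ) (decode : ℕ → V)
    (encode-decode : ∀ n → encode (decode n) ≡ n)
    (C : Set ℓc)
    (χ' : List ℕ → ℕ) (χ'-fresh : ∀ ns → χ' ns ∉ ns)
    (𝒜 : C → C → Set ℓa) (ℛ : C → C → C → Set ℓr) →
    let open PTS V _≟V_ encode decode encode-decode C χ' χ'-fresh 𝒜 ℛ in
    ∀ (Γ : Context) (x y : V) (A M B : Term) →
    y ∉ dom Γ →
    ((x , A) ∷ Γ) ⊢ M ∶ B →
    ((y , A) ∷ Γ) ⊢ M [ x := v y ] ∶ (B [ x := v y ])
lemma23 V _≟V_ encode decode encode-decode C χ' χ'-fresh 𝒜 ℛ =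
  PTS-Properties.⊢-rename-head V _≟V_ encode decode encode-decode C χ' χ'-fresh 𝒜 ℛ
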